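{- Consider the following construction: given an interpretation $f:\{0,1\}\to\{\emptyset,0,1,E\}$ and a bit string $x=x_1\cdots x_n\in\{0,1\}^n$, let $G$ be the graph on $\{1,\dots,n\}$ in which vertex $t$ has label $\ell(t)=x_t$ and, for $i<t$, $\{i,t\}$ is an edge iff $f(x_t)=E$, or $f(x_t)\in\{0,1\}$ and $f(x_t)=\ell(i)$. Then: (i) for every $f$, every $x$ and every $k\ge 5$, $G$ contains neither the path $P_k$ nor the cycle $C_k$ as an induced subgraph; (ii) there exist $f$ and $x$ for which $G$ contains an induced $P_4$, and there exist $f$ and $x$ for which $G$ contains an induced $C_4$.
   Context: This is the model where at each step a builder receives one instruction bit, remembers one bit (the label) per vertex, has no randomness, and joins the new vertex to all earlier vertices ($E$), none ($\emptyset$), or all earlier vertices with a specified label ($0$ or $1$); edges among earlier vertices are never added. $P_k$ is the path on $k$ vertices and $C_k$ the cycle on $k$ vertices. -}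

module Defs where

open import Data.Nat using (ℕ; zero; suc; _+_; _≤_; _<_)
open import Data.Fin using (Fin; toℕ)
open import Data.Bool using (Bool; true; false)
open import Data.Product using (_×_; Σ; _,_)
open import Data.Sum using (_⊎_)
open import Data.Empty using (⊥)
open import Data.Unit using (⊤)
open import Relation.Binary.PropositionalEquality using (_≡_)
open import Function.Definitions using (Injective)
open import Function.Bundles using (_⇔_)

-- Instruction types: join to nobody (∅), to all earlier vertices with
-- label b (lab b), or to all earlier vertices (E).
data Instr : Set where
  ∅   : Instr
  lab : Bool → Instr
  E   : Instr

Interpretation : Set
Interpretation = Bool → Instr

Joins : Instr → Bool → Set
Joins ∅       _  = ⊥
Joins E       _  = ⊤
Joins (lab b) ℓi = b ≡ ℓi

Adj : {n : ℕ} → Interpretation → (Fin n → Bool) → Fin n → Fin n → Set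
Adj f x i j =
    (toℕ i < toℕ j × Joins (f (x j)) (x i))
  ⊎ (toℕ j < toℕ i × Joins (f (x i)) (x j))

PathAdj : {k : ℕ} → Fin k → Fin k → Set
PathAdj a b = (suc (toℕ a) ≡ toℕ b) ⊎ (suc (toℕ b) ≡ toℕ a)

CycleAdj : {k : ℕ} → Fin k → Fin k → Set
CycleAdj {k} a b =
  PathAdj a b
  ⊎ (toℕ a ≡ 0 × suc (toℕ b) ≡ k)
  ⊎ (toℕ b ≡ 0 × suc (toℕ a) ≡ k)

InducedCopy : {k n : ℕ} → (Fin k → Fin k → Set) → (Fin n → Fin n → Set) → Set
InducedCopy {k} {n} HAdj GAdj =
  Σ (Fin k → Fin n) λ φ →
    Injective _≡_ _≡_ φ × (∀ a b → HAdj a b ⇔ GAdj (φ a) (φ b))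

HasInducedPath : {n : ℕ} → (k : ℕ) → (Fin n → Fin n → Set) → Set
HasInducedPath k G = InducedCopy (PathAdj {k}) G

HasInducedCycle : {n : ℕ} → (k : ℕ) → (Fin n → Fin n → Set) → Set
HasInducedCycle k G = InducedCopy (CycleAdj {k}) G

-- Adjacency between vertices i < j depends only on their labels.  Hence every label class
-- is a clique or an independent set, and a vertex adjacent to exactly one of two equally
-- labelled vertices a, b lies strictly between them.  So there are no u, u′ of one label
-- and a, b of one label with u ~ a, u′ ~ b, u ≁ b, u′ ≁ a: both u and u′ would lie between
-- a and b, while a would lie between u and u′.  Every 2-colouring of P₅ or C₅ shows one of
-- these patterns (checked by exhaustion): some colour class has 3 vertices, which span an
-- edge and a non-edge unless they are {0,2,4} in P₅, and then {1,3} crosses {0,4}.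
-- Longer induced paths and cycles contain an induced P₅.
module Submission where

open import Defs
open import Data.Nat using (ℕ; _≤_; _<_; suc)
open import Data.Nat.Properties
  using (<-irrefl; <-asym; <-trans; <-cmp; <⇒≤; ≤-<-trans; m≤n⇒m<n∨m≡n) renaming (_≟_ to _≟ℕ_; _<?_ to _<ℕ?_)
open import Data.Fin using (Fin; toℕ; inject≤; #_) renaming (_≟_ to _≟ᶠ_)
open import Data.Fin.Properties using (toℕ-injective; toℕ-inject≤; toℕ<n; inject≤-injective; any?; all?)
open import Data.Fin.Subset.Properties using (anySubset?)
open import Data.Bool using (Bool; true; false; not) renaming (_≟_ to _≟ᵇ_)
open import Data.Vec using (Vec; []; _∷_; lookup; tabulate)
open import Data.Vec.Properties using (lookup∘tabulate)
open import Data.Product using (_×_; Σ; ∃₂; _,_)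
open import Data.Sum using (_⊎_; inj₁; inj₂; swap; [_,_])
open import Data.Empty using (⊥; ⊥-elim)
open import Data.Unit using (tt)
open import Function using (_∘_; id)
open import Function.Bundles using (_⇔_; mk⇔; Equivalence)
open import Function.Construct.Composition using (_⇔-∘_)
open import Function.Construct.Identity using (⇔-id)
open import Function.Construct.Symmetry using (⇔-sym)
open import Function.Definitions using (Injective)
open import Relation.Binary using (Decidable; tri<; tri≈; tri>)
open import Relation.Binary.PropositionalEquality using (_≡_; _≢_; ≢-sym; refl; sym; trans; cong; subst₂)
open import Relation.Nullary using (¬_; Dec; yes; no; ¬?)
open import Relation.Nullary.Decidable using (from-yes; map′; decidable-stable; _×-dec_; _⊎-dec_; _→-dec_)

Joins? : ∀ ins b → Dec (Joins ins b)
Joins? ∅       _ = no λ ()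
Joins? E       _ = yes tt
Joins? (lab c) b = c ≟ᵇ b

Adj? : (f : Interpretation) {n : ℕ} (x : Fin n → Bool) → Decidable (Adj f x)
Adj? f x i j = ((toℕ i <ℕ? toℕ j) ×-dec Joins? (f (x j)) (x i))
         ⊎-dec ((toℕ j <ℕ? toℕ i) ×-dec Joins? (f (x i)) (x j))

PathAdj? : ∀ {k} → Decidable (PathAdj {k})
PathAdj? a b = (suc (toℕ a) ≟ℕ toℕ b) ⊎-dec (suc (toℕ b) ≟ℕ toℕ a)

CycleAdj? : ∀ {k} → Decidable (CycleAdj {k})
CycleAdj? {k} a b = PathAdj? a b
  ⊎-dec ((toℕ a ≟ℕ 0) ×-dec (suc (toℕ b) ≟ℕ k))
  ⊎-dec ((toℕ b ≟ℕ 0) ×-dec (suc (toℕ a) ≟ℕ k))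

_⇔?_ : ∀ {A B : Set} → Dec A → Dec B → Dec (A ⇔ B)
A? ⇔? B? = map′ (λ (to , from) → mk⇔ to from) (λ e → Equivalence.to e , Equivalence.from e)
                ((A? →-dec B?) ×-dec (B? →-dec A?))

InducedCopy? : ∀ {k n} {H : Fin k → Fin k → Set} {G : Fin n → Fin n → Set} →
               Decidable H → Decidable G → (φ : Fin k → Fin n) →
               Dec (Injective _≡_ _≡_ φ × (∀ a b → H a b ⇔ G (φ a) (φ b)))
InducedCopy? H? G? φ =
  map′ (λ (inj , iso) → (λ {a} {b} → inj a b) , iso) (λ (inj , iso) → (λ a b → inj) , iso)
       (all? (λ a → all? λ b → (φ a ≟ᶠ φ b) →-dec (a ≟ᶠ b))
         ×-dec all? (λ a → all? λ b → H? a b ⇔? G? (φ a) (φ b)))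

InducedCopy-trans : ∀ {k m n} {H : Fin k → Fin k → Set} {K : Fin m → Fin m → Set}
                    {G : Fin n → Fin n → Set} → InducedCopy H K → InducedCopy K G → InducedCopy H G
InducedCopy-trans (ψ , ψ-inj , ψ-iso) (φ , φ-inj , φ-iso) =
  φ ∘ ψ , ψ-inj ∘ φ-inj , λ a b → φ-iso (ψ a) (ψ b) ⇔-∘ ψ-iso a b

PathAdj-inject≤ : ∀ {m k} (m≤k : m ≤ k) (a b : Fin m) →
                  PathAdj (inject≤ a m≤k) (inject≤ b m≤k) ⇔ PathAdj a b
PathAdj-inject≤ m≤k a b rewrite toℕ-inject≤ a m≤k | toℕ-inject≤ b m≤k = ⇔-id _

Path⊑Path : ∀ {m k} → m ≤ k → InducedCopy (PathAdj {m}) (PathAdj {k})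
Path⊑Path m≤k = (λ a → inject≤ a m≤k) , inject≤-injective m≤k m≤k _ _ ,
                λ a b → ⇔-sym (PathAdj-inject≤ m≤k a b)

Path⊑Cycle : ∀ {m k} → m < k → InducedCopy (PathAdj {m}) (CycleAdj {k})
Path⊑Cycle {m} {k} m<k = ι , inject≤-injective m≤k m≤k _ _ ,
                         λ a b → mk⇔ (inj₁ ∘ from (PathAdj-inject≤ m≤k a b)) (fromCycle a b)
  where
  open Equivalence
  m≤k = <⇒≤ m<k
  ι = λ (a : Fin m) → inject≤ a m≤k

  no-wrap : ∀ b → suc (toℕ (ι b)) ≢ k
  no-wrap b eq = <-irrefl (trans (cong suc (sym (toℕ-inject≤ b m≤k))) eq) (≤-<-trans (toℕ<n b) m<k)

  fromCycle : ∀ a b → CycleAdj (ι a) (ι b) → PathAdj a b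
  fromCycle a b (inj₁ p)              = to (PathAdj-inject≤ m≤k a b) p
  fromCycle a b (inj₂ (inj₁ (_ , w))) = ⊥-elim (no-wrap b w)
  fromCycle a b (inj₂ (inj₂ (_ , w))) = ⊥-elim (no-wrap a w)

Between : ℕ → ℕ → ℕ → Set
Between i j k = i < j × j < k

Separates : ℕ → ℕ → ℕ → Set
Separates u a b = Between a u b ⊎ Between b u a

separations-conflict : ∀ {u u′ a b} → Separates u a b → Separates u′ a b → ¬ Separates a u u′
separations-conflict (inj₁ (a<u , _)) (inj₁ _) (inj₁ (u<a , _)) = <-asym a<u u<a
separations-conflict (inj₁ _) (inj₁ (a<u′ , _)) (inj₂ (u′<a , _)) = <-asym a<u′ u′<a
separations-conflict (inj₁ (a<u , u<b)) (inj₂ (b<u′ , u′<a)) _ =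
  <-asym (<-trans a<u u<b) (<-trans b<u′ u′<a)
separations-conflict (inj₂ (b<u , u<a)) (inj₁ (a<u′ , u′<b)) _ =
  <-asym (<-trans a<u′ u′<b) (<-trans b<u u<a)
separations-conflict (inj₂ _) (inj₂ (_ , u′<a)) (inj₁ (_ , a<u′)) = <-asym a<u′ u′<a
separations-conflict (inj₂ (_ , u<a)) (inj₂ _) (inj₂ (_ , a<u)) = <-asym a<u u<a

module _ (f : Interpretation) {n : ℕ} (x : Fin n → Bool) where
  open Equivalence

  Adj-sym : ∀ {i j} → Adj f x i j → Adj f x j i
  Adj-sym (inj₁ p) = inj₂ p
  Adj-sym (inj₂ p) = inj₁ p

  Adj-irrefl : ∀ {i j} → Adj f x i j → i ≢ j
  Adj-irrefl (inj₁ (i<j , _)) refl = <-irrefl refl i<j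
  Adj-irrefl (inj₂ (j<i , _)) refl = <-irrefl refl j<i

  Adj⇔Joins : ∀ {i j} → toℕ i < toℕ j → Adj f x i j ⇔ Joins (f (x j)) (x i)
  Adj⇔Joins i<j = mk⇔ earlier (λ J → inj₁ (i<j , J))
    where
    earlier : Adj f x _ _ → Joins _ _
    earlier (inj₁ (_ , J))   = J
    earlier (inj₂ (j<i , _)) = ⊥-elim (<-asym i<j j<i)

  Adj-relabel : ∀ {i j p q} → toℕ i < toℕ j → toℕ p < toℕ q → x i ≡ x p → x j ≡ x q →
                Adj f x i j → Adj f x p q
  Adj-relabel i<j p<q xi≡xp xj≡xq ij =
    from (Adj⇔Joins p<q) (subst₂ (λ c d → Joins (f d) c) xi≡xp xj≡xq (to (Adj⇔Joins i<j) ij))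

  Adj-within-label⇔ : ∀ {c i j} → x i ≡ c → x j ≡ c → i ≢ j → Adj f x i j ⇔ Joins (f c) c
  Adj-within-label⇔ {c} {i} {j} xi xj i≢j with <-cmp (toℕ i) (toℕ j)
  ... | tri< i<j _ _ = subst₂ (λ d e → Adj f x i j ⇔ Joins (f e) d) xi xj (Adj⇔Joins i<j)
  ... | tri≈ _ i≡j _ = ⊥-elim (i≢j (toℕ-injective i≡j))
  ... | tri> _ _ j<i = subst₂ (λ d e → Adj f x j i ⇔ Joins (f e) d) xj xi (Adj⇔Joins j<i)
                         ⇔-∘ mk⇔ Adj-sym Adj-sym

  Adj-separates : ∀ {u a b} → x a ≡ x b → u ≢ b → Adj f x u a → ¬ Adj f x u b →
                  Separates (toℕ u) (toℕ a) (toℕ b)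
  Adj-separates {u} {a} {b} xa≡xb u≢b ua ¬ub with <-cmp (toℕ u) (toℕ a) | <-cmp (toℕ u) (toℕ b)
  ... | tri≈ _ u≡a _ | _            = ⊥-elim (Adj-irrefl ua (toℕ-injective u≡a))
  ... | _            | tri≈ _ u≡b _ = ⊥-elim (u≢b (toℕ-injective u≡b))
  ... | tri< u<a _ _ | tri< u<b _ _ = ⊥-elim (¬ub (Adj-relabel u<a u<b refl xa≡xb ua))
  ... | tri> _ _ a<u | tri> _ _ b<u =
        ⊥-elim (¬ub (Adj-sym (Adj-relabel a<u b<u xa≡xb refl (Adj-sym ua))))
  ... | tri> _ _ a<u | tri< u<b _ _ = inj₁ (a<u , u<b)
  ... | tri< u<a _ _ | tri> _ _ b<u = inj₂ (b<u , u<a)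

  Adj-no-crossing : ∀ {u u′ a b} → x u ≡ x u′ → x a ≡ x b → u ≢ b → u′ ≢ a →
                    Adj f x u a → Adj f x u′ b → ¬ Adj f x u b → ¬ Adj f x u′ a → ⊥
  Adj-no-crossing xu≡xu′ xa≡xb u≢b u′≢a ua u′b ¬ub ¬u′a =
    separations-conflict
      (Adj-separates xa≡xb u≢b ua ¬ub)
      (swap (Adj-separates (sym xa≡xb) u′≢a u′b ¬u′a))
      (Adj-separates xu≡xu′ (≢-sym u′≢a) (Adj-sym ua) (¬u′a ∘ Adj-sym))

MixedClass : ∀ {k} → (Fin k → Fin k → Set) → (Fin k → Bool) → Set
MixedClass H c = ∃₂ λ u w → ∃₂ λ p q →
  c u ≡ c w × c u ≡ c p × c u ≡ c q × p ≢ q × H u w × ¬ H p q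

Crossing : ∀ {k} → (Fin k → Fin k → Set) → (Fin k → Bool) → Set
Crossing H c = ∃₂ λ u u′ → ∃₂ λ a b →
  c u ≡ c u′ × c a ≡ c b × u ≢ b × u′ ≢ a × H u a × H u′ b × ¬ H u b × ¬ H u′ a

Obstruction : ∀ {k} → (Fin k → Fin k → Set) → (Fin k → Bool) → Set
Obstruction H c = MixedClass H c ⊎ Crossing H c

Obstruction? : ∀ {k} {H : Fin k → Fin k → Set} → Decidable H → ∀ c → Dec (Obstruction H c)
Obstruction? H? c = mixedClass? ⊎-dec crossing?
  where
  mixedClass? = any? λ u → any? λ w → any? λ p → any? λ q →
    (c u ≟ᵇ c w) ×-dec (c u ≟ᵇ c p) ×-dec (c u ≟ᵇ c q) ×-dec ¬? (p ≟ᶠ q)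
    ×-dec H? u w ×-dec ¬? (H? p q)
  crossing? = any? λ u → any? λ u′ → any? λ a → any? λ b →
    (c u ≟ᵇ c u′) ×-dec (c a ≟ᵇ c b) ×-dec ¬? (u ≟ᶠ b) ×-dec ¬? (u′ ≟ᶠ a)
    ×-dec H? u a ×-dec H? u′ b ×-dec ¬? (H? u b) ×-dec ¬? (H? u′ a)

-- A colouring of Fin k is a Vec Bool k, i.e. a Subset k, so anySubset? enumerates them all.
∀-colouring? : ∀ {k} {P : Vec Bool k → Set} → (∀ s → Dec (P s)) → Dec (∀ s → P s)
∀-colouring? P? = map′ (λ ∄¬P s → decidable-stable (P? s) (λ ¬Ps → ∄¬P (s , ¬Ps)))
                       (λ ∀P (s , ¬Ps) → ¬Ps (∀P s))
                       (¬? (anySubset? (¬? ∘ P?)))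

P₅-obstructed : ∀ (s : Vec Bool 5) → Obstruction PathAdj (lookup s)
P₅-obstructed = from-yes (∀-colouring? (Obstruction? (PathAdj? {5}) ∘ lookup))

C₅-obstructed : ∀ (s : Vec Bool 5) → Obstruction CycleAdj (lookup s)
C₅-obstructed = from-yes (∀-colouring? (Obstruction? (CycleAdj? {5}) ∘ lookup))

module _ {k : ℕ} {H : Fin k → Fin k → Set} (f : Interpretation) {n : ℕ} (x : Fin n → Bool) where

  module _ {φ : Fin k → Fin n} (φ-inj : Injective _≡_ _≡_ φ)
           (φ-iso : ∀ a b → H a b ⇔ Adj f x (φ a) (φ b))
           {c : Fin k → Bool} (colour : ∀ i → x (φ i) ≡ c i) where
    open Equivalence

    private
      edge : ∀ {a b} → H a b → Adj f x (φ a) (φ b)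
      edge {a} {b} = to (φ-iso a b)

      non-edge : ∀ {a b} → ¬ H a b → ¬ Adj f x (φ a) (φ b)
      non-edge {a} {b} ¬ab = ¬ab ∘ from (φ-iso a b)

      same-label : ∀ {i j} → c i ≡ c j → x (φ j) ≡ x (φ i)
      same-label {i} {j} ci≡cj = trans (colour j) (trans (sym ci≡cj) (sym (colour i)))

    InducedCopy-no-MixedClass : ¬ MixedClass H c
    InducedCopy-no-MixedClass (u , w , p , q , cu≡cw , cu≡cp , cu≡cq , p≢q , uw , ¬pq) =
      non-edge ¬pq (from pq⇔self-join (to uw⇔self-join (edge uw)))
      where
      self-join = Joins (f (x (φ u))) (x (φ u))
      uw⇔self-join : Adj f x (φ u) (φ w) ⇔ self-join
      uw⇔self-join = Adj-within-label⇔ f x refl (same-label cu≡cw) (Adj-irrefl f x (edge uw))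
      pq⇔self-join : Adj f x (φ p) (φ q) ⇔ self-join
      pq⇔self-join = Adj-within-label⇔ f x (same-label cu≡cp) (same-label cu≡cq) (p≢q ∘ φ-inj)

    InducedCopy-no-Crossing : ¬ Crossing H c
    InducedCopy-no-Crossing (u , u′ , a , b , cu≡cu′ , ca≡cb , u≢b , u′≢a , ua , u′b , ¬ub , ¬u′a) =
      Adj-no-crossing f x (sym (same-label cu≡cu′)) (sym (same-label ca≡cb))
        (u≢b ∘ φ-inj) (u′≢a ∘ φ-inj) (edge ua) (edge u′b) (non-edge ¬ub) (non-edge ¬u′a)

  no-InducedCopy : (∀ (s : Vec Bool k) → Obstruction H (lookup s)) → ¬ InducedCopy H (Adj f x)
  no-InducedCopy obstructed (φ , φ-inj , φ-iso) =
    [ InducedCopy-no-MixedClass φ-inj φ-iso colour , InducedCopy-no-Crossing φ-inj φ-iso colour ]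
      (obstructed (tabulate (x ∘ φ)))
    where
    colour : ∀ i → x (φ i) ≡ lookup (tabulate (x ∘ φ)) i
    colour = sym ∘ lookup∘tabulate (x ∘ φ)

module _ (f : Interpretation) {n : ℕ} (x : Fin n → Bool) where

  no-InducedPath : ∀ {k} → 5 ≤ k → ¬ HasInducedPath k (Adj f x)
  no-InducedPath 5≤k Pₖ =
    no-InducedCopy f x P₅-obstructed (InducedCopy-trans {G = Adj f x} (Path⊑Path 5≤k) Pₖ)

  no-InducedCycle : ∀ {k} → 5 ≤ k → ¬ HasInducedCycle k (Adj f x)
  no-InducedCycle 5≤k with m≤n⇒m<n∨m≡n 5≤k
  ... | inj₁ 5<k  = λ Cₖ →
    no-InducedCopy f x P₅-obstructed (InducedCopy-trans {G = Adj f x} (Path⊑Cycle 5<k) Cₖ)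
  ... | inj₂ refl = no-InducedCopy f x C₅-obstructed

alternating : Fin 4 → Bool
alternating = lookup (false ∷ true ∷ false ∷ true ∷ [])

join-0-to-1 : Interpretation
join-0-to-1 false = ∅
join-0-to-1 true  = lab false

join-other-label : Interpretation
join-other-label b = lab (not b)

P₄-example : HasInducedPath 4 (Adj join-0-to-1 alternating)
P₄-example = φ , from-yes (InducedCopy? (PathAdj? {4}) (Adj? join-0-to-1 alternating) φ)
  where
  φ : Fin 4 → Fin 4
  φ = lookup (# 1 ∷ # 0 ∷ # 3 ∷ # 2 ∷ [])

C₄-example : HasInducedCycle 4 (Adj join-other-label alternating)
C₄-example = id , from-yes (InducedCopy? (CycleAdj? {4}) (Adj? join-other-label alternating) id)

corollary2 : ((f : Interpretation) (n : ℕ) (x : Fin n → Bool) (k : ℕ) → 5 ≤ k →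
    ¬ HasInducedPath k (Adj f x) × ¬ HasInducedCycle k (Adj f x))
    × Σ Interpretation (λ f → Σ ℕ (λ n → Σ (Fin n → Bool) (λ x →
    HasInducedPath 4 (Adj f x))))
    × Σ Interpretation (λ f → Σ ℕ (λ n → Σ (Fin n → Bool) (λ x →
    HasInducedCycle 4 (Adj f x))))
corollary2 =
  (λ f n x k 5≤k → no-InducedPath f x 5≤k , no-InducedCycle f x 5≤k) ,
  (join-0-to-1 , 4 , alternating , P₄-example) ,
  (join-other-label , 4 , alternating , C₄-example)
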